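{- Let $k \leq n$ be positive integers, let $\lambda = (\lambda_1 \geq \cdots \geq \lambda_s\ge 0)$ be a partition of $k$ with $s$ parts, and let $\sigma \in \mathcal{OP}_{n,\lambda}$. Then $\mathtt{code}(\sigma) \leq \mathtt{maxcode}(\sigma)$ componentwise.
   Context: A partition of $k$ with $s$ parts is a weakly decreasing sequence of $s$ nonnegative integers (trailing zeros allowed) summing to $k$; $\lambda'$ is its conjugate ($\lambda'_j=\#\{i:\lambda_i\ge j\}$). $\mathcal{OP}_{n,\lambda}$ is the set of sequences $\sigma=(B_1\mid\cdots\mid B_s)$ of (possibly empty) subsets of $[n]$ with $[n]=B_1\sqcup\cdots\sqcup B_s$ and $|B_i|\ge\lambda_i$. Container diagram: column $i$ has $\lambda_i$ top-justified boxes (rows numbered from the top); the box in row $j$ ($1\le j\le \lambda_i$) of column $i$ holds the $(\lambda_i-j+1)$-th smallest element of $B_i$; the other $|B_i|-\lambda_i$ (largest) elements of $B_i$ are floating in block $i$. Row $j$ contains $\lambda'_j$ entries. "To the right/left" refers to block indices. For $1\le i<j\le n$, $(i,j)$ is a coinversion of $\sigma$ if: (a) $i$ is floating, $j$ is in a block to the right of $i$, and $j$ is in the top row of the container; or (b) $i$ is not floating, $j$ is in a block to the right of $i$, and $i,j$ are in the same container row; or (c) $i$ is not floating, $j$ is in a block to the left of $i$, and $j$ is in the container row directly below that of $i$. Let $c_i$ be the number of $j>i$ with $(i,j)$ a coinversion, plus $p-1$ if $i$ is floating in block $p$; $\mathtt{code}(\sigma)=(c_1,\dots,c_n)$. $\mathtt{maxcode}(\sigma)=(a_1,\dots,a_n)$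 is defined by: if $i$ is floating, $a_i=s-1$; if $i$ is the $m$-th smallest entry of row $j$ of the container, $a_i=\lambda'_j-m$. -}

module Defs where

open import Data.Nat using (ℕ; zero; suc; _+_; _∸_; _≤_; _≥_; _<_)
open import Data.Fin using (Fin; toℕ) renaming (zero to fzero; suc to fsuc)
import Data.Fin as F
import Data.Nat as N
open import Data.Bool using (Bool; true; false; _∧_; if_then_else_)
open import Data.Maybe using (Maybe; just; nothing)
open import Relation.Nullary.Decidable using (⌊_⌋)

sumF : ∀ {m} → (Fin m → ℕ) → ℕ
sumF {zero}  f = 0
sumF {suc m} f = f fzero + sumF (λ i → f (fsuc i))

count : ∀ {m} → (Fin m → Bool) → ℕ
count p = sumF (λ i → if p i then 1 else 0)

_==ᶠ_ : ∀ {m} → Fin m → Fin m → Bool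
a ==ᶠ b = ⌊ a F.≟ b ⌋

_<ᶠ_ : ∀ {m} → Fin m → Fin m → Bool
a <ᶠ b = ⌊ a F.<? b ⌋

_==_ : ℕ → ℕ → Bool
a == b = ⌊ a N.≟ b ⌋

IsPartition : (k s : ℕ) → (Fin s → ℕ) → Set
IsPartition k s lam = (∀ (i j : Fin s) → toℕ i ≤ toℕ j → lam j ≤ lam i) × (sumF lam ≡ k)
  where
  open import Data.Product using (_×_)
  open import Relation.Binary.PropositionalEquality using (_≡_)

conj : ∀ {s} → (Fin s → ℕ) → ℕ → ℕ
conj lam j = count (λ i → ⌊ j N.≤? lam i ⌋)

-- An ordered set partition σ = (B_1 | ... | B_s) of [n] is encoded by
-- blk : Fin n → Fin s, with B_{b+1} = blk⁻¹(b) (elements and blocks 0-indexed).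
-- Block size |B_b|.
blockSize : ∀ {n s} → (Fin n → Fin s) → Fin s → ℕ
blockSize blk b = count (λ x → blk x ==ᶠ b)

InOP : ∀ {n s} → (Fin s → ℕ) → (Fin n → Fin s) → Set
InOP lam blk = ∀ b → lam b ≤ blockSize blk b

-- rank of x inside its block: number of smaller elements in the same block
-- (x is the (rank+1)-th smallest element of its block).
rank : ∀ {n s} → (Fin n → Fin s) → Fin n → ℕ
rank blk x = count (λ y → (y <ᶠ x) ∧ (blk y ==ᶠ blk x))

-- Container row of x (rows numbered from 1 at the top), or nothing if x is floating.
-- The (r+1)-th smallest element of block b (r = rank) sits in row λ_b - r when r < λ_b;
-- otherwise it is floating.
row : ∀ {n s} → (Fin s → ℕ) → (Fin n → Fin s) → Fin n → Maybe ℕ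
row lam blk x with ⌊ rank blk x N.<? lam (blk x) ⌋
... | true  = just (lam (blk x) ∸ rank blk x)
... | false = nothing

inRow : ∀ {n s} → (Fin s → ℕ) → (Fin n → Fin s) → ℕ → Fin n → Bool
inRow lam blk j y with row lam blk y
... | just r  = r == j
... | nothing = false

-- (x, y) is a coinversion (the condition x < y is imposed separately).
coinv : ∀ {n s} → (Fin s → ℕ) → (Fin n → Fin s) → Fin n → Fin n → Bool
coinv lam blk x y with row lam blk x
-- (a) x floating, y in a block to the right, y in the top row
... | nothing = (blk x <ᶠ blk y) ∧ inRow lam blk 1 y
-- (b) same row, y to the right;  (c) y to the left, y in the row directly below
... | just j  = ((blk x <ᶠ blk y) ∧ inRow lam blk j y)
              Data.Bool.∨ ((blk y <ᶠ blk x) ∧ inRow lam blk (suc j) y)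
  where import Data.Bool

code : ∀ {n s} → (Fin s → ℕ) → (Fin n → Fin s) → Fin n → ℕ
code lam blk x with row lam blk x
... | nothing = count (λ y → (x <ᶠ y) ∧ coinv lam blk x y) + toℕ (blk x)
... | just _  = count (λ y → (x <ᶠ y) ∧ coinv lam blk x y)

maxcode : ∀ {n s} → (Fin s → ℕ) → (Fin n → Fin s) → Fin n → ℕ
maxcode {s = s} lam blk x with row lam blk x
... | nothing = s ∸ 1
... | just j  = conj lam j ∸ suc (count (λ y → (y <ᶠ x) ∧ inRow lam blk j y))

module Submission where

-- If x is floating in block p, its coinversions (x, y) all have y in the
-- top row of a block to the right of p; each block has only one top-row element,
-- so there are at most s - p such y, and code_x ≤ (s - p) + (p - 1) = s - 1.
-- If x sits in container row j, charge to row j the set consisting of x, the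
-- smaller entries of row j, and the coinversion partners y > x (row j to the
-- right, or row j+1 to the left).  Distinct charged elements lie in distinct
-- blocks, all of whose columns reach row j, so there are at most λ'_j of them;
-- this is exactly code_x ≤ λ'_j - m.  The key geometric fact is that inside one
-- block the rows decrease as the elements increase.

open import Defs
open import Data.Nat using (ℕ; _≤_; _<_)
open import Data.Fin using (Fin)

open import Data.Nat using (zero; suc; _+_; _∸_; z≤n; s≤s; _≤?_; _<?_)
open import Data.Nat.Properties
import Data.Nat as ℕ
open import Algebra.Properties.CommutativeSemigroup +-commutativeSemigroup using (interchange)
open import Data.Fin using (toℕ) renaming (zero to fzero; suc to fsuc)
import Data.Fin as F
import Data.Fin.Properties as FP
open import Data.Bool using (Bool; true; false; T; _∧_; _∨_; if_then_else_)
open import Data.Bool.Properties using (T-∧; T-∨)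
open import Data.Maybe using (just; nothing)
open import Data.Maybe.Properties using (just-injective)
open import Data.Product using (_×_; _,_; proj₁; proj₂)
open import Data.Sum using (_⊎_; inj₁; inj₂)
open import Data.Empty using (⊥-elim)
open import Relation.Nullary using (¬_; yes; no)
open import Relation.Nullary.Decidable using (⌊_⌋; toWitness; fromWitness)
open import Relation.Binary.PropositionalEquality
open import Relation.Binary using (tri<; tri≈; tri>)
open import Function using (case_of_; Equivalence)

-- Boolean tests, read as propositions via T, with the first argument explicit
-- so that they apply to stuck boolean expressions.

∧-elim : ∀ a {b} → T (a ∧ b) → T a × T b
∧-elim a = Equivalence.to (T-∧ {a})

∧-intro : ∀ {a b} → T a → T b → T (a ∧ b)
∧-intro {a} ta tb = Equivalence.from (T-∧ {a}) (ta , tb)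

∨-elim : ∀ a {b} → T (a ∨ b) → T a ⊎ T b
∨-elim a = Equivalence.to (T-∨ {a})

==ᶠ⇒≡ : ∀ {m} {a b : Fin m} → T (a ==ᶠ b) → a ≡ b
==ᶠ⇒≡ {a = a} {b} = toWitness {a? = a F.≟ b}

≡⇒==ᶠ : ∀ {m} {a b : Fin m} → a ≡ b → T (a ==ᶠ b)
≡⇒==ᶠ {a = a} {b} = fromWitness {a? = a F.≟ b}

<ᶠ⇒< : ∀ {m} {a b : Fin m} → T (a <ᶠ b) → a F.< b
<ᶠ⇒< {a = a} {b} = toWitness {a? = a F.<? b}

<⇒<ᶠ : ∀ {m} {a b : Fin m} → a F.< b → T (a <ᶠ b)
<⇒<ᶠ {a = a} {b} = fromWitness {a? = a F.<? b}

ind : Bool → ℕ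
ind b = if b then 1 else 0

sumF-cong : ∀ {m} {f g : Fin m → ℕ} → (∀ i → f i ≡ g i) → sumF f ≡ sumF g
sumF-cong {zero}  h = refl
sumF-cong {suc m} h = cong₂ _+_ (h fzero) (sumF-cong (λ i → h (fsuc i)))

sumF-mono : ∀ {m} {f g : Fin m → ℕ} → (∀ i → f i ≤ g i) → sumF f ≤ sumF g
sumF-mono {zero}  h = z≤n
sumF-mono {suc m} h = +-mono-≤ (h fzero) (sumF-mono (λ i → h (fsuc i)))

sumF-+ : ∀ {m} (f g : Fin m → ℕ) → sumF (λ i → f i + g i) ≡ sumF f + sumF g
sumF-+ {zero}  f g = refl
sumF-+ {suc m} f g = begin
  (f fzero + g fzero) + sumF (λ i → f (fsuc i) + g (fsuc i))
    ≡⟨ cong ((f fzero + g fzero) +_) (sumF-+ (λ i → f (fsuc i)) (λ i → g (fsuc i))) ⟩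
  (f fzero + g fzero) + (sumF (λ i → f (fsuc i)) + sumF (λ i → g (fsuc i)))
    ≡⟨ interchange (f fzero) (g fzero) _ _ ⟩
  (f fzero + sumF (λ i → f (fsuc i))) + (g fzero + sumF (λ i → g (fsuc i)))   ∎
  where open ≡-Reasoning

sumF-zero : ∀ {m} (f : Fin m → ℕ) → (∀ i → f i ≡ 0) → sumF f ≡ 0
sumF-zero {zero}  f h = refl
sumF-zero {suc m} f h rewrite h fzero = sumF-zero (λ i → f (fsuc i)) (λ i → h (fsuc i))

sumF-swap : ∀ {m k} (f : Fin m → Fin k → ℕ) →
  sumF (λ i → sumF (f i)) ≡ sumF (λ c → sumF (λ i → f i c))
sumF-swap {zero} {k} f = sym (sumF-zero {k} (λ _ → 0) (λ _ → refl))
sumF-swap {suc m} f = begin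
  sumF (f fzero) + sumF (λ i → sumF (f (fsuc i)))
    ≡⟨ cong (sumF (f fzero) +_) (sumF-swap (λ i → f (fsuc i))) ⟩
  sumF (f fzero) + sumF (λ c → sumF (λ i → f (fsuc i) c))
    ≡⟨ sym (sumF-+ (f fzero) (λ c → sumF (λ i → f (fsuc i) c))) ⟩
  sumF (λ c → f fzero c + sumF (λ i → f (fsuc i) c))   ∎
  where open ≡-Reasoning

count-none : ∀ {m} (p : Fin m → Bool) → (∀ i → ¬ T (p i)) → count p ≡ 0
count-none p h = sumF-zero _ indicator
  where
  indicator : ∀ i → ind (p i) ≡ 0
  indicator i with p i | h i
  ... | false | _  = refl
  ... | true  | ¬t = ⊥-elim (¬t _)

count-all : ∀ {m} (p : Fin m → Bool) → (∀ i → T (p i)) → count p ≡ m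
count-all {zero}  p h = refl
count-all {suc m} p h with p fzero | h fzero
... | true | _ = cong suc (count-all (λ i → p (fsuc i)) (λ i → h (fsuc i)))

count-unique : ∀ {m} (p : Fin m → Bool) (a : Fin m) → T (p a) →
  (∀ i → T (p i) → i ≡ a) → count p ≡ 1
count-unique p fzero pa h with p fzero
... | true = cong suc (count-none (λ i → p (fsuc i)) (λ i t → case (h (fsuc i) t) of λ ()))
count-unique p (fsuc a) pa h with p fzero | h fzero
... | false | _ = count-unique (λ i → p (fsuc i)) a pa (λ i t → FP.suc-injective (h (fsuc i) t))
... | true  | h0 with h0 _
... | ()

ind-mono : ∀ {a b} → (T a → T b) → ind a ≤ ind b
ind-mono {false}         h = z≤n
ind-mono {true}  {true}  h = ≤-refl
ind-mono {true}  {false} h = ⊥-elim (h _)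

count-mono : ∀ {m} (p q : Fin m → Bool) → (∀ i → T (p i) → T (q i)) → count p ≤ count q
count-mono p q h = sumF-mono (λ i → ind-mono (h i))

count-strict : ∀ {m} (p q : Fin m → Bool) → (∀ i → T (p i) → T (q i)) →
  (a : Fin m) → T (q a) → ¬ T (p a) → count p < count q
count-strict p q h fzero qa ¬pa with p fzero | q fzero
... | false | true = s≤s (count-mono (λ i → p (fsuc i)) (λ i → q (fsuc i)) (λ i → h (fsuc i)))
... | true  | _    = ⊥-elim (¬pa _)
count-strict p q h (fsuc a) qa ¬pa =
  +-mono-≤-< (ind-mono (h fzero))
    (count-strict (λ i → p (fsuc i)) (λ i → q (fsuc i)) (λ i → h (fsuc i)) a qa ¬pa)

count-∨ : ∀ {m} (p q : Fin m → Bool) → (∀ i → T (p i) → ¬ T (q i)) →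
  count (λ i → p i ∨ q i) ≡ count p + count q
count-∨ p q disj = trans (sumF-cong indicator) (sumF-+ (λ i → ind (p i)) (λ i → ind (q i)))
  where
  indicator : ∀ i → ind (p i ∨ q i) ≡ ind (p i) + ind (q i)
  indicator i with p i | q i | disj i
  ... | false | _     | _ = refl
  ... | true  | false | _ = refl
  ... | true  | true  | d = ⊥-elim (d _ _)

count-fibres : ∀ {m k} (p : Fin m → Bool) (f : Fin m → Fin k) →
  count p ≡ sumF (λ c → count (λ y → p y ∧ (f y ==ᶠ c)))
count-fibres p f = trans (sumF-cong (λ y → indicator (p y) (f y)))
                         (sumF-swap (λ y c → ind (p y ∧ (f y ==ᶠ c))))
  where
  indicator : ∀ {k} (b : Bool) (a : Fin k) → ind b ≡ sumF (λ c → ind (b ∧ (a ==ᶠ c)))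
  indicator {k} false a = sym (sumF-zero {k} (λ _ → 0) (λ _ → refl))
  indicator true a = sym (count-unique (a ==ᶠ_) a (≡⇒==ᶠ refl) (λ c t → sym (==ᶠ⇒≡ t)))

count-subsingleton : ∀ {m} (p : Fin m → Bool) (d : Bool) → (∀ i → T (p i) → T d) →
  (∀ i j → T (p i) → T (p j) → i ≡ j) → count p ≤ ind d
count-subsingleton {zero} p d w u = z≤n
count-subsingleton {suc m} p d w u with p fzero in e
... | false = ≤-trans (count-subsingleton (λ i → p (fsuc i)) d (λ i → w (fsuc i))
                         (λ i j ti tj → FP.suc-injective (u (fsuc i) (fsuc j) ti tj)))
                      (ind-mono {d} (λ t → t))
... | true = ≤-trans (≤-reflexive (cong suc (count-none (λ i → p (fsuc i)) rest)))
                     (ind-mono {true} {d} (λ _ → w fzero (subst T (sym e) _)))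
  where
  rest : ∀ i → ¬ T (p (fsuc i))
  rest i t = case u fzero (fsuc i) (subst T (sym e) _) t of λ ()

count-injection : ∀ {m k} (p : Fin m → Bool) (q : Fin k → Bool) (f : Fin m → Fin k) →
  (∀ y → T (p y) → T (q (f y))) →
  (∀ y z → T (p y) → T (p z) → f y ≡ f z → y ≡ z) →
  count p ≤ count q
count-injection p q f into inj = begin
  count p                                         ≡⟨ count-fibres p f ⟩
  sumF (λ c → count (λ y → p y ∧ (f y ==ᶠ c)))    ≤⟨ sumF-mono fibre-bound ⟩
  count q                                         ∎
  where
  open ≤-Reasoning
  fibre-bound : ∀ c → count (λ y → p y ∧ (f y ==ᶠ c)) ≤ ind (q c)
  fibre-bound c = count-subsingleton _ (q c) lands collide
    where
    lands : ∀ y → T (p y ∧ (f y ==ᶠ c)) → T (q c)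
    lands y t with ∧-elim (p y) t
    ... | py , fy = subst (λ d → T (q d)) (==ᶠ⇒≡ fy) (into y py)
    collide : ∀ y z → T (p y ∧ (f y ==ᶠ c)) → T (p z ∧ (f z ==ᶠ c)) → y ≡ z
    collide y z ty tz with ∧-elim (p y) ty | ∧-elim (p z) tz
    ... | py , fy | pz , fz = inj y z py pz (trans (==ᶠ⇒≡ fy) (sym (==ᶠ⇒≡ fz)))

count-above : ∀ {s} (b : Fin s) → count (b <ᶠ_) + toℕ b ≡ s ∸ 1
count-above {suc s} fzero = begin
  count (fzero {s} <ᶠ_) + 0  ≡⟨ +-identityʳ _ ⟩
  count (fzero {s} <ᶠ_)      ≡⟨ count-all (λ c → fzero <ᶠ fsuc c) (λ c → <⇒<ᶠ {b = fsuc c} (s≤s z≤n)) ⟩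
  s                          ∎
  where open ≡-Reasoning
count-above {suc (suc s)} (fsuc b) = begin
  count (fsuc b <ᶠ_) + suc (toℕ b)  ≡⟨ cong (_+ suc (toℕ b)) (sumF-cong (λ c → cong ind (shift c))) ⟩
  count (b <ᶠ_) + suc (toℕ b)       ≡⟨ +-suc _ _ ⟩
  suc (count (b <ᶠ_) + toℕ b)       ≡⟨ cong suc (count-above b) ⟩
  suc s                             ∎
  where
  open ≡-Reasoning
  shift : ∀ c → (fsuc b <ᶠ fsuc c) ≡ (b <ᶠ c)
  shift c with fsuc b F.<? fsuc c | b F.<? c
  ... | yes _         | yes _   = refl
  ... | no  _         | no  _   = refl
  ... | yes (s≤s b<c) | no  b≮c = ⊥-elim (b≮c b<c)
  ... | no  sb≮sc     | yes b<c = ⊥-elim (sb≮sc (s≤s b<c))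

module Container {n s : ℕ} (lam : Fin s → ℕ) (blk : Fin n → Fin s) where

  InRow : ℕ → Fin n → Set
  InRow j y = rank blk y < lam (blk y) × lam (blk y) ∸ rank blk y ≡ j

  row-just : ∀ {y j} → row lam blk y ≡ just j → InRow j y
  row-just {y} eq with rank blk y <? lam (blk y)
  ... | yes r<λ = r<λ , just-injective eq
  ... | no  _   = case eq of λ ()

  inRow-sound : ∀ {j y} → T (inRow lam blk j y) → InRow j y
  inRow-sound {j} {y} t with row lam blk y in eq
  ... | just r = let r<λ , λ∸r≡r = row-just eq in r<λ , trans λ∸r≡r (toWitness t)

  inRow-complete : ∀ {j y} → row lam blk y ≡ just j → T (inRow lam blk j y)
  inRow-complete {j} eq rewrite eq = fromWitness {a? = j ℕ.≟ j} refl

  row≤column : ∀ {j y} → InRow j y → j ≤ lam (blk y)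
  row≤column {y = y} (_ , λ∸r≡j) = subst (_≤ lam (blk y)) λ∸r≡j (m∸n≤m _ (rank blk y))

  rank-increasing : ∀ {y z} → y F.< z → blk y ≡ blk z → rank blk y < rank blk z
  rank-increasing {y} {z} y<z same = count-strict below-y below-z grow y
    (∧-intro (<⇒<ᶠ y<z) (≡⇒==ᶠ same)) (λ t → FP.<-irrefl refl (<ᶠ⇒< (proj₁ (∧-elim (y <ᶠ y) t))))
    where
    below-y below-z : Fin n → Bool
    below-y w = (w <ᶠ y) ∧ (blk w ==ᶠ blk y)
    below-z w = (w <ᶠ z) ∧ (blk w ==ᶠ blk z)
    grow : ∀ w → T (below-y w) → T (below-z w)
    grow w t with ∧-elim (w <ᶠ y) t
    ... | w<y , bw = ∧-intro (<⇒<ᶠ (FP.<-trans (<ᶠ⇒< w<y) y<z)) (≡⇒==ᶠ (trans (==ᶠ⇒≡ bw) same))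

  row-decreasing : ∀ {i j y z} → blk y ≡ blk z → y F.< z → InRow i y → InRow j z → j < i
  row-decreasing {i} {j} {y} {z} same y<z (_ , λ∸ry≡i) (rz<λ , λ∸rz≡j) =
    subst₂ _<_ λ∸rz≡j (trans (cong (λ b → lam b ∸ rank blk y) (sym same)) λ∸ry≡i)
      (∸-monoʳ-< (rank-increasing y<z same) (<⇒≤ rz<λ))

  row-unique : ∀ {j y z} → blk y ≡ blk z → InRow j y → InRow j z → y ≡ z
  row-unique same ry rz with FP.<-cmp _ _
  ... | tri< y<z _ _ = ⊥-elim (<-irrefl refl (row-decreasing same y<z ry rz))
  ... | tri≈ _ y≡z _ = y≡z
  ... | tri> _ _ z<y = ⊥-elim (<-irrefl refl (row-decreasing (sym same) z<y rz ry))

  lower-row-smaller : ∀ {j y z} → blk y ≡ blk z → InRow (suc j) y → InRow j z → y F.< z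
  lower-row-smaller {j} same ry rz with FP.<-cmp _ _
  ... | tri< y<z _ _ = y<z
  ... | tri≈ _ refl _ = ⊥-elim (<-irrefl (trans (sym (proj₂ rz)) (proj₂ ry)) (n<1+n j))
  ... | tri> _ _ z<y = ⊥-elim (<-asym (row-decreasing (sym same) z<y rz ry) (n<1+n j))

  coinv-after : Fin n → Fin n → Bool
  coinv-after x y = (x <ᶠ y) ∧ coinv lam blk x y

  coinv-floating : ∀ {x} y → row lam blk x ≡ nothing →
    coinv lam blk x y ≡ (blk x <ᶠ blk y) ∧ inRow lam blk 1 y
  coinv-floating y eq rewrite eq = refl

  coinv-in-row : ∀ {x j} y → row lam blk x ≡ just j →
    coinv lam blk x y ≡ ((blk x <ᶠ blk y) ∧ inRow lam blk j y)
                        ∨ ((blk y <ᶠ blk x) ∧ inRow lam blk (suc j) y)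
  coinv-in-row y eq rewrite eq = refl

  -- A floating x is in coinversion only with top-row elements of later blocks;
  -- blk is injective on them, so there are at most as many as later blocks.
  floating-bound : ∀ x → row lam blk x ≡ nothing →
    count (coinv-after x) ≤ count (blk x <ᶠ_)
  floating-bound x eq = count-injection (coinv-after x) (blk x <ᶠ_) blk
    (λ y t → proj₁ (later-top y t))
    (λ y z ty tz same → row-unique same (proj₂ (later-top y ty)) (proj₂ (later-top z tz)))
    where
    later-top : ∀ y → T (coinv-after x y) → T (blk x <ᶠ blk y) × InRow 1 y
    later-top y t with ∧-elim (blk x <ᶠ blk y) (subst T (coinv-floating y eq) (proj₂ (∧-elim (x <ᶠ y) t)))
    ... | later , top = later , inRow-sound top

  -- For x in row j, the coinversions of x, the smaller entries of row j and x
  -- itself together occupy at most one box of row j per column, hence at most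
  -- λ'_j elements.
  module InContainer (x : Fin n) (j : ℕ) (eq : row lam blk x ≡ just j) where

    earlier-in-row : Fin n → Bool
    earlier-in-row y = (y <ᶠ x) ∧ inRow lam blk j y

    charged : Fin n → Bool
    charged y = (coinv-after x y ∨ earlier-in-row y) ∨ (y ==ᶠ x)

    data Charged (y : Fin n) : Set where
      same-row  : InRow j y → (x F.< y → blk x F.< blk y) → Charged y
      row-below : x F.< y → blk y F.< blk x → InRow (suc j) y → Charged y

    classify : ∀ y → T (charged y) → Charged y
    classify y t with ∨-elim (coinv-after x y ∨ earlier-in-row y) t
    ... | inj₂ y=x rewrite ==ᶠ⇒≡ {a = y} y=x =
      same-row (row-just eq) (λ x<x → ⊥-elim (FP.<-irrefl refl x<x))
    ... | inj₁ t′ with ∨-elim (coinv-after x y) t′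
    ... | inj₂ earlier with ∧-elim (y <ᶠ x) earlier
    ...   | y<x , r = same-row (inRow-sound r) (λ x<y → ⊥-elim (FP.<-asym x<y (<ᶠ⇒< y<x)))
    classify y t | inj₁ t′ | inj₁ co with ∧-elim (x <ᶠ y) co
    ... | x<y , c with ∨-elim ((blk x <ᶠ blk y) ∧ inRow lam blk j y) (subst T (coinv-in-row y eq) c)
    ...   | inj₁ b = let later , r = ∧-elim (blk x <ᶠ blk y) b
                     in same-row (inRow-sound r) (λ _ → <ᶠ⇒< later)
    ...   | inj₂ c′ = let earlier , r = ∧-elim (blk y <ᶠ blk x) c′
                      in row-below (<ᶠ⇒< x<y) (<ᶠ⇒< earlier) (inRow-sound r)

    charged-column : ∀ {y} → Charged y → j ≤ lam (blk y)
    charged-column (same-row r _)      = row≤column r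
    charged-column (row-below _ _ r)   = ≤-trans (n≤1+n j) (row≤column r)

    -- The only delicate case is a
    -- row-j element z above a row-(j+1) element y > x of the same block:
    -- then x < y < z, so blk z lies after blk x, yet blk z = blk y lies before it.
    charged-injective : ∀ {y z} → blk y ≡ blk z → Charged y → Charged z → y ≡ z
    charged-injective same (same-row ry _) (same-row rz _) = row-unique same ry rz
    charged-injective same (row-below _ _ ry) (row-below _ _ rz) = row-unique same ry rz
    charged-injective same (row-below x<y earlier ry) (same-row rz later) =
      ⊥-elim (FP.<-asym (subst (F._< blk x) same earlier)
                        (later (FP.<-trans x<y (lower-row-smaller same ry rz))))
    charged-injective same (same-row ry later) (row-below x<z earlier rz) =
      ⊥-elim (FP.<-asym (subst (F._< blk x) (sym same) earlier)
                        (later (FP.<-trans x<z (lower-row-smaller (sym same) rz ry))))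

    charged≤conj : count charged ≤ conj lam j
    charged≤conj = count-injection charged (λ c → ⌊ j ≤? lam c ⌋) blk
      (λ y t → fromWitness (charged-column (classify y t)))
      (λ y z ty tz same → charged-injective same (classify y ty) (classify z tz))

    count-charged : count charged ≡ count (coinv-after x) + suc (count earlier-in-row)
    count-charged = begin
      count charged
        ≡⟨ count-∨ _ (_==ᶠ x) (λ y t y=x → not-self y t (==ᶠ⇒≡ y=x)) ⟩
      count (λ y → coinv-after x y ∨ earlier-in-row y) + count (_==ᶠ x)
        ≡⟨ cong₂ _+_ (count-∨ (coinv-after x) earlier-in-row (λ y a e → after-not-before y a e))
                     (count-unique (_==ᶠ x) x (≡⇒==ᶠ refl) (λ y t → ==ᶠ⇒≡ t)) ⟩
      (count (coinv-after x) + count earlier-in-row) + 1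
        ≡⟨ +-assoc (count (coinv-after x)) _ 1 ⟩
      count (coinv-after x) + (count earlier-in-row + 1)
        ≡⟨ cong (count (coinv-after x) +_) (+-comm _ 1) ⟩
      count (coinv-after x) + suc (count earlier-in-row)   ∎
      where
      open ≡-Reasoning
      after-not-before : ∀ y → T (coinv-after x y) → ¬ T (earlier-in-row y)
      after-not-before y a e = FP.<-asym (<ᶠ⇒< (proj₁ (∧-elim (x <ᶠ y) a)))
                                         (<ᶠ⇒< (proj₁ (∧-elim (y <ᶠ x) e)))
      not-self : ∀ y → T (coinv-after x y ∨ earlier-in-row y) → ¬ y ≡ x
      not-self y t refl with ∨-elim (coinv-after x x) t
      ... | inj₁ a = FP.<-irrefl refl (<ᶠ⇒< (proj₁ (∧-elim (x <ᶠ x) a)))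
      ... | inj₂ e = FP.<-irrefl refl (<ᶠ⇒< (proj₁ (∧-elim (x <ᶠ x) e)))

    container-bound : count (coinv-after x) ≤ conj lam j ∸ suc (count earlier-in-row)
    container-bound = m+n≤o⇒m≤o∸n (count (coinv-after x))
                        (subst (_≤ conj lam j) count-charged charged≤conj)

lemma3p5 : (k n s : ℕ) → 1 ≤ k → k ≤ n →
    (lam : Fin s → ℕ) → IsPartition k s lam →
    (blk : Fin n → Fin s) → InOP lam blk →
    ∀ (x : Fin n) → code lam blk x ≤ maxcode lam blk x
lemma3p5 k n s _ _ lam _ blk _ x with row lam blk x in eq
... | just j  = InContainer.container-bound x j eq
  where open Container lam blk
... | nothing = begin
  count (coinv-after x) + toℕ (blk x)   ≤⟨ +-monoˡ-≤ (toℕ (blk x)) (floating-bound x eq) ⟩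
  count (blk x <ᶠ_) + toℕ (blk x)       ≡⟨ count-above (blk x) ⟩
  s ∸ 1                                 ∎
  where open Container lam blk
        open ≤-Reasoning
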